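{- Let $m,n$ be positive integers with $m \equiv 13 \pmod{16}$ and $n \equiv 5 \pmod{16}$. Then $K_m \Box K_n$ has an $L_8$-decomposition.
   Context: $K_m$ is the complete graph on $m$ vertices. The Cartesian product $G \Box H$ has vertex set $V(G)\times V(H)$, with $(g,h)$ adjacent to $(g',h')$ iff either $g=g'$ and $hh'\in E(H)$, or $h=h'$ and $gg'\in E(G)$. The sunlet graph $L_8$ is the graph on 8 vertices $x_1,\dots,x_8$ with edge set $\{x_1x_2,x_2x_3,x_3x_4,x_4x_1,x_1x_5,x_2x_6,x_3x_7,x_4x_8\}$. An $L_8$-decomposition of a graph $G$ is a partition of $E(G)$ into sets each inducing a subgraph isomorphic to $L_8$. -}

module Defs where

open import Data.Nat using (ℕ)
open import Data.Fin using (Fin; zero; suc; #_)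
open import Data.Product using (_×_; Σ; ∃; ∃-syntax; _,_; proj₁; proj₂)
open import Data.Sum using (_⊎_)
open import Relation.Binary.PropositionalEquality using (_≡_; _≢_)
open import Function.Definitions using (Injective)

-- A simple undirected graph: vertex type and (symmetric, irreflexive) adjacency.
record Graph : Set₁ where
  field
    V   : Set
    Adj : V → V → Set
open Graph public

K : ℕ → Graph
K m = record { V = Fin m ; Adj = λ x y → x ≢ y }

_□_ : Graph → Graph → Graph
G □ H = record
  { V   = V G × V H
  ; Adj = λ p q →
      (proj₁ p ≡ proj₁ q × Adj H (proj₂ p) (proj₂ q))
      ⊎ (proj₂ p ≡ proj₂ q × Adj G (proj₁ p) (proj₁ q)) }

-- The sunlet graph L_8 on vertices x1..x8 (encoded as Fin 8, x_i ↦ i-1).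
-- Its 8 edges, indexed by Fin 8:
-- x1x2, x2x3, x3x4, x4x1, x1x5, x2x6, x3x7, x4x8.
L8-edge : Fin 8 → Fin 8 × Fin 8
L8-edge zero = (# 0 , # 1)
L8-edge (suc zero) = (# 1 , # 2)
L8-edge (suc (suc zero)) = (# 2 , # 3)
L8-edge (suc (suc (suc zero))) = (# 3 , # 0)
L8-edge (suc (suc (suc (suc zero)))) = (# 0 , # 4)
L8-edge (suc (suc (suc (suc (suc zero))))) = (# 1 , # 5)
L8-edge (suc (suc (suc (suc (suc (suc zero)))))) = (# 2 , # 6)
L8-edge (suc (suc (suc (suc (suc (suc (suc zero))))))) = (# 3 , # 7)

-- Its edge set is the image of the 8 edges of L_8, and the
-- subgraph induced by that edge set is isomorphic to L_8.
record L8Copy (G : Graph) : Set where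
  field
    vert  : Fin 8 → V G
    inj   : Injective _≡_ _≡_ vert
    edges : (e : Fin 8) → Adj G (vert (proj₁ (L8-edge e))) (vert (proj₂ (L8-edge e)))
open L8Copy public

Covers : {G : Graph} → L8Copy G → Fin 8 → V G → V G → Set
Covers c e u v =
  (vert c (proj₁ (L8-edge e)) ≡ u × vert c (proj₂ (L8-edge e)) ≡ v)
  ⊎ (vert c (proj₁ (L8-edge e)) ≡ v × vert c (proj₂ (L8-edge e)) ≡ u)

-- An L_8-decomposition of G: finitely many copies of L_8 (indexed by Fin k)
-- whose edge sets partition E(G): every edge {u,v} of G is covered by exactly
-- one edge of exactly one copy.  (Every copy edge is an edge of G by L8Copy.)
record L8Decomposition (G : Graph) : Set where
  field
    k      : ℕ
    copy   : Fin k → L8Copy G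
    cover  : ∀ u v → Adj G u v → ∃[ i ] ∃[ e ] Covers (copy i) e u v
    unique : ∀ u v → Adj G u v → ∀ i e i' e' →
             Covers (copy i) e u v → Covers (copy i') e' u v →
             i ≡ i' × e ≡ e'

module Submission where

-- Write m = 2hm + 1 and n = 2hn + 1 with hm = 6 + 8a, hn = 2 + 8b, and view
-- the vertex set as the torus Z_m × Z_n.  Every edge of K_m □ K_n is a
-- segment {S, S + d·u_dr} for a unique base point S, direction dr
-- (horizontal or vertical) and length 1 ≤ d ≤ h_dr; the pair (dr, d) is the
-- edge's difference.  A difference family is a finite set of copies of L_8 drawn
-- in the plane ℕ², whose 8·(#blocks) edges realise every admissible
-- difference exactly once; translating every block by every point of the
-- torus then yields an L_8-decomposition (`Torus.Translates`).

open import Data.Nat using (ℕ; suc; _+_; _*_; _∸_; _≤_; _<_; z≤n; s≤s; NonZero)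
open import Data.Nat.Properties
open import Data.Nat.DivMod
  using (_%_; _/_; _mod_; m≡m%n+[m/n]*n; m%n<n; m<n⇒m%n≡m; %-distribˡ-+; m%n%n≡m%n;
         [m+kn]%n≡m%n; [m+n]%n≡m%n; m<n*o⇒m/o<n)
open import Data.Fin using (Fin; toℕ; fromℕ<)
open import Data.Fin.Patterns
open import Data.Fin.Properties using (toℕ-injective; toℕ-fromℕ<; toℕ<n; *↔×; +↔⊎; 1↔⊤)
open import Data.Product using (Σ; ∃-syntax; _×_; _,_; proj₁; proj₂) renaming (map to ×-map)
open import Data.Product.Function.NonDependent.Propositional using (_×-↔_)
open import Data.Sum using (_⊎_; inj₁; inj₂) renaming (map to ⊎-map)
open import Data.Sum.Function.Propositional using (_⊎-↔_)
open import Data.Unit using (⊤; tt)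
open import Data.Empty using (⊥-elim)
open import Function.Base using (_∘′_)
open import Function.Bundles using (_↔_; Inverse; Injection)
open import Function.Definitions using (Injective)
open import Function.Properties.Inverse using (↔-trans; ↔⇒↣)
open import Relation.Binary.PropositionalEquality
open import Relation.Binary.Definitions using (tri<; tri≈; tri>)
open import Relation.Nullary using (yes; no)
open import Algebra.Properties.CommutativeSemigroup +-commutativeSemigroup
  using (x∙yz≈y∙xz; interchange)
open import Defs

private variable
  A B : Set
  a b p q x y : A

-- The unordered pairs {a, b} and {p, q} coincide.  `Covers c e u v` of Defs
-- is by definition `SamePair` of the endpoints of edge e of c and {u, v}.
SamePair : A → A → A → A → Set
SamePair a b p q = (a ≡ p × b ≡ q) ⊎ (a ≡ q × b ≡ p)

SamePair-swap : SamePair a b b a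
SamePair-swap = inj₂ (refl , refl)

SamePair-sym : SamePair a b p q → SamePair p q a b
SamePair-sym (inj₁ (refl , refl)) = inj₁ (refl , refl)
SamePair-sym (inj₂ (refl , refl)) = inj₂ (refl , refl)

SamePair-trans : SamePair a b p q → SamePair p q x y → SamePair a b x y
SamePair-trans (inj₁ (refl , refl)) s                    = s
SamePair-trans (inj₂ (refl , refl)) (inj₁ (refl , refl)) = inj₂ (refl , refl)
SamePair-trans (inj₂ (refl , refl)) (inj₂ (refl , refl)) = inj₁ (refl , refl)

SamePair-map : (f : A → B) → SamePair a b p q → SamePair (f a) (f b) (f p) (f q)
SamePair-map f (inj₁ (refl , refl)) = inj₁ (refl , refl)
SamePair-map f (inj₂ (refl , refl)) = inj₂ (refl , refl)

SamePair-diagonalˡ : SamePair a a p q → p ≡ q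
SamePair-diagonalˡ (inj₁ (refl , refl)) = refl
SamePair-diagonalˡ (inj₂ (refl , refl)) = refl

SamePair-diagonalʳ : SamePair a b p p → a ≡ p
SamePair-diagonalʳ (inj₁ (a≡p , _)) = a≡p
SamePair-diagonalʳ (inj₂ (a≡p , _)) = a≡p

-- Copies indexed by any type I in bijection with some Fin k that cover every
-- edge exactly once form an L_8-decomposition; this frees the construction
-- from the Fin-indexing required by `L8Decomposition`.
decomposition-from-family :
  {G : Graph} {I : Set} {k : ℕ} → Fin k ↔ I → (copy : I → L8Copy G) →
  (∀ u v → Adj G u v → ∃[ ι ] ∃[ e ] Covers (copy ι) e u v) →
  (∀ u v ι e ι' e' → Covers (copy ι) e u v → Covers (copy ι') e' u v → ι ≡ ι' × e ≡ e') →
  L8Decomposition G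
decomposition-from-family {G} {k = k} index copy cover unique = record
  { k = k ; copy = copy ∘′ to ; cover = cover′ ; unique = unique′ }
  where
  open Inverse index

  cover′ : ∀ u v → Adj G u v → ∃[ i ] ∃[ e ] Covers (copy (to i)) e u v
  cover′ u v adj with cover u v adj
  ... | ι , e , c = from ι , e , subst (λ ι′ → Covers (copy ι′) e u v) (sym (strictlyInverseˡ ι)) c

  unique′ : ∀ u v → Adj G u v → ∀ i e i' e' →
            Covers (copy (to i)) e u v → Covers (copy (to i')) e' u v → i ≡ i' × e ≡ e'
  unique′ u v _ i e i' e' c c' with unique u v (to i) e (to i') e' c c'
  ... | ι≡ι' , e≡e' = Injection.injective (↔⇒↣ index) ι≡ι' , e≡e'

-- The cyclic group Z_m, realised on Fin m, with naturals acting by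
-- translation: a ⊕ x is the residue of a + x.
module Cyclic (m : ℕ) .{{_ : NonZero m}} where

  infixl 6 _⊕_ _⊖_

  _⊕_ : Fin m → ℕ → Fin m
  a ⊕ x = (toℕ a + x) mod m

  toℕ-mod : ∀ x → toℕ (x mod m) ≡ x % m
  toℕ-mod x = toℕ-fromℕ< (m%n<n x m)

  mod-cong : ∀ {x y} → x % m ≡ y % m → x mod m ≡ y mod m
  mod-cong {x} {y} eq = toℕ-injective (trans (toℕ-mod x) (trans eq (sym (toℕ-mod y))))

  toℕ-mod-inverse : ∀ (a : Fin m) → toℕ a mod m ≡ a
  toℕ-mod-inverse a = toℕ-injective (trans (toℕ-mod (toℕ a)) (m<n⇒m%n≡m (toℕ<n a)))

  mod-⊕ : ∀ x y → x mod m ⊕ y ≡ (x + y) mod m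
  mod-⊕ x y = mod-cong (begin
    (toℕ (x mod m) + y) % m  ≡⟨ cong (λ r → (r + y) % m) (toℕ-mod x) ⟩
    (x % m + y) % m          ≡⟨ %-distribˡ-+ (x % m) y m ⟩
    (x % m % m + y % m) % m  ≡⟨ cong (λ r → (r + y % m) % m) (m%n%n≡m%n x m) ⟩
    (x % m + y % m) % m      ≡⟨ %-distribˡ-+ x y m ⟨
    (x + y) % m              ∎)
    where open ≡-Reasoning

  ⊕-assoc : ∀ a x y → a ⊕ x ⊕ y ≡ a ⊕ (x + y)
  ⊕-assoc a x y = trans (mod-⊕ (toℕ a + x) y) (cong (_mod m) (+-assoc (toℕ a) x y))

  ⊕-identityʳ : ∀ a → a ⊕ 0 ≡ a
  ⊕-identityʳ a = trans (cong (_mod m) (+-identityʳ (toℕ a))) (toℕ-mod-inverse a)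

  ⊕-m : ∀ a → a ⊕ m ≡ a
  ⊕-m a = trans (mod-cong ([m+n]%n≡m%n (toℕ a) m)) (toℕ-mod-inverse a)

  ⊕-period : ∀ a k → a ⊕ k * m ≡ a
  ⊕-period a k = trans (mod-cong ([m+kn]%n≡m%n (toℕ a) k m)) (toℕ-mod-inverse a)

  neg : ℕ → ℕ
  neg x = m ∸ x % m

  +-neg : ∀ x → x + neg x ≡ suc (x / m) * m
  +-neg x = begin
    x + neg x                      ≡⟨ cong (_+ neg x) (m≡m%n+[m/n]*n x m) ⟩
    (x % m + x / m * m) + neg x    ≡⟨ cong (_+ neg x) (+-comm (x % m) (x / m * m)) ⟩
    (x / m * m + x % m) + neg x    ≡⟨ +-assoc (x / m * m) (x % m) (neg x) ⟩
    x / m * m + (x % m + neg x)    ≡⟨ cong (x / m * m +_) (m+[n∸m]≡n (<⇒≤ (m%n<n x m))) ⟩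
    x / m * m + m                  ≡⟨ +-comm (x / m * m) m ⟩
    suc (x / m) * m                ∎
    where open ≡-Reasoning

  ⊕-neg : ∀ a x → a ⊕ x ⊕ neg x ≡ a
  ⊕-neg a x = begin
    a ⊕ x ⊕ neg x          ≡⟨ ⊕-assoc a x (neg x) ⟩
    a ⊕ (x + neg x)        ≡⟨ cong (a ⊕_) (+-neg x) ⟩
    a ⊕ suc (x / m) * m    ≡⟨ ⊕-period a (suc (x / m)) ⟩
    a                      ∎
    where open ≡-Reasoning

  _⊖_ : Fin m → ℕ → Fin m
  a ⊖ x = a ⊕ neg x

  ⊖-⊕ : ∀ a x → a ⊖ x ⊕ x ≡ a
  ⊖-⊕ a x = begin
    a ⊕ neg x ⊕ x          ≡⟨ ⊕-assoc a (neg x) x ⟩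
    a ⊕ (neg x + x)        ≡⟨ cong (a ⊕_) (trans (+-comm (neg x) x) (+-neg x)) ⟩
    a ⊕ suc (x / m) * m    ≡⟨ ⊕-period a (suc (x / m)) ⟩
    a                      ∎
    where open ≡-Reasoning

  ⊕-cancelʳ : ∀ {a b} x → a ⊕ x ≡ b ⊕ x → a ≡ b
  ⊕-cancelʳ {a} {b} x eq = trans (sym (⊕-neg a x)) (trans (cong (_⊕ neg x) eq) (⊕-neg b x))

  ⊕-cancelˡ : ∀ a {x y} → x < m → y < m → a ⊕ x ≡ a ⊕ y → x ≡ y
  ⊕-cancelˡ a {x} {y} x<m y<m eq = begin
    x               ≡⟨ m<n⇒m%n≡m x<m ⟨
    x % m           ≡⟨ toℕ-mod x ⟨
    toℕ (x mod m)   ≡⟨ cong toℕ (⊕-cancelʳ (toℕ a) (trans (swap x) (trans eq (sym (swap y))))) ⟩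
    toℕ (y mod m)   ≡⟨ toℕ-mod y ⟩
    y % m           ≡⟨ m<n⇒m%n≡m y<m ⟩
    y               ∎
    where
    open ≡-Reasoning
    swap : ∀ z → z mod m ⊕ toℕ a ≡ a ⊕ z
    swap z = trans (mod-⊕ z (toℕ a)) (cong (_mod m) (+-comm z (toℕ a)))

  ⊕-no-fixpoint : ∀ a {d} → 1 ≤ d → d < m → a ≢ a ⊕ d
  ⊕-no-fixpoint a {d} 1≤d d<m a≡a⊕d =
    <⇒≢ 1≤d (⊕-cancelˡ a (≤-<-trans z≤n d<m) d<m (trans (⊕-identityʳ a) a≡a⊕d))

InRange : ℕ → ℕ → Set
InRange h d = 1 ≤ d × d ≤ h

module OddCycle (h : ℕ) where

  m : ℕ
  m = suc (h + h)

  open Cyclic m public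

  ≤h⇒<m : ∀ {d} → d ≤ h → d < m
  ≤h⇒<m d≤h = s≤s (≤-trans d≤h (m≤m+n h h))

  -- If {s, s ⊕ d} = {s' ⊕ d', s'} instead, then s' = s' ⊕ (d' + d) with
  -- 0 < d' + d < m, which is impossible.
  short-unique : ∀ {s s' d d'} → InRange h d → InRange h d' →
                 SamePair s (s ⊕ d) s' (s' ⊕ d') → s ≡ s' × d ≡ d'
  short-unique {s} (_ , d≤h) (_ , d'≤h) (inj₁ (refl , s⊕d≡s⊕d')) =
    refl , ⊕-cancelˡ s (≤h⇒<m d≤h) (≤h⇒<m d'≤h) s⊕d≡s⊕d'
  short-unique {s' = s'} {d} {d'} (1≤d , d≤h) (_ , d'≤h) (inj₂ (refl , s'⊕d'⊕d≡s')) =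
    ⊥-elim (⊕-no-fixpoint s' (≤-trans 1≤d (m≤n+m d d')) (s≤s (+-mono-≤ d'≤h d≤h))
                          (sym (trans (sym (⊕-assoc s' d' d)) s'⊕d'⊕d≡s')))

  -- For a < b with δ = b - a: either δ ≤ h and the pair is {a, a ⊕ δ},
  -- or the pair is {b, b ⊕ (m - δ)}.
  short-exists< : ∀ (a b : Fin m) → toℕ a < toℕ b →
                  Σ (Fin m) λ s → Σ ℕ λ d → InRange h d × SamePair a b s (s ⊕ d)
  short-exists< a b a<b with toℕ b ∸ toℕ a ≤? h
  ... | yes δ≤h = a , toℕ b ∸ toℕ a , (m<n⇒0<n∸m a<b , δ≤h) , inj₁ (refl , sym a⊕δ≡b)
    where
    a⊕δ≡b : a ⊕ (toℕ b ∸ toℕ a) ≡ b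
    a⊕δ≡b = trans (cong (_mod m) (m+[n∸m]≡n (<⇒≤ a<b))) (toℕ-mod-inverse b)
  ... | no δ≰h = b , m ∸ δ , (m<n⇒0<n∸m δ<m , m∸δ≤h) , inj₂ (sym b⊕[m∸δ]≡a , refl)
    where
    δ : ℕ
    δ = toℕ b ∸ toℕ a
    δ<m : δ < m
    δ<m = ≤-<-trans (m∸n≤m (toℕ b) (toℕ a)) (toℕ<n b)
    m∸δ≤h : m ∸ δ ≤ h
    m∸δ≤h = ≤-trans (∸-monoʳ-≤ m (≰⇒> δ≰h)) (≤-reflexive (m+n∸n≡m h h))
    b⊕[m∸δ]≡a : b ⊕ (m ∸ δ) ≡ a
    b⊕[m∸δ]≡a = begin
      (toℕ b + (m ∸ δ)) mod m         ≡⟨ cong (λ z → (z + (m ∸ δ)) mod m) (m+[n∸m]≡n (<⇒≤ a<b)) ⟨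
      ((toℕ a + δ) + (m ∸ δ)) mod m   ≡⟨ cong (_mod m) (+-assoc (toℕ a) δ (m ∸ δ)) ⟩
      (toℕ a + (δ + (m ∸ δ))) mod m   ≡⟨ cong (λ z → (toℕ a + z) mod m) (m+[n∸m]≡n (<⇒≤ δ<m)) ⟩
      a ⊕ m                           ≡⟨ ⊕-m a ⟩
      a                               ∎
      where open ≡-Reasoning

  short-exists : ∀ (a b : Fin m) → a ≢ b →
                 Σ (Fin m) λ s → Σ ℕ λ d → InRange h d × SamePair a b s (s ⊕ d)
  short-exists a b a≢b with <-cmp (toℕ a) (toℕ b)
  ... | tri< a<b _ _ = short-exists< a b a<b
  ... | tri≈ _ a≡b _ = ⊥-elim (a≢b (toℕ-injective a≡b))
  ... | tri> _ _ b<a with short-exists< b a b<a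
  ...   | s , d , r , ba = s , d , r , SamePair-trans SamePair-swap ba

src tgt : Fin 8 → Fin 8
src e = proj₁ (L8-edge e)
tgt e = proj₂ (L8-edge e)

-- Base blocks are drawn in the plane ℕ², before reduction modulo (m, n).
Plane : Set
Plane = ℕ × ℕ

data Dir : Set where
  horizontal vertical : Dir

move : Dir → ℕ → Plane → Plane
move horizontal d (x , y) = (x + d , y)
move vertical   d (x , y) = (x , y + d)

module Torus (hm hn : ℕ) where

  module H = OddCycle hm
  module V = OddCycle hn
  open H using (m)
  open V using () renaming (m to n)

  Point : Set
  Point = Fin m × Fin n

  G : Graph
  G = K m □ K n

  bound : Dir → ℕ
  bound horizontal = hm
  bound vertical   = hn

  shift : Dir → ℕ → Point → Point
  shift horizontal d (a , b) = (a H.⊕ d , b)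
  shift vertical   d (a , b) = (a , b V.⊕ d)

  adj-sym : ∀ {u v} → Adj G u v → Adj G v u
  adj-sym = ⊎-map (×-map sym ≢-sym) (×-map sym ≢-sym)

  adj-respects-SamePair : ∀ {u v S T} → SamePair u v S T → Adj G S T → Adj G u v
  adj-respects-SamePair (inj₁ (refl , refl)) adj = adj
  adj-respects-SamePair (inj₂ (refl , refl)) adj = adj-sym adj

  segment-adj : ∀ S dr {d} → InRange (bound dr) d → Adj G S (shift dr d S)
  segment-adj (a , b) horizontal (1≤d , d≤h) = inj₂ (refl , H.⊕-no-fixpoint a 1≤d (H.≤h⇒<m d≤h))
  segment-adj (a , b) vertical   (1≤d , d≤h) = inj₁ (refl , V.⊕-no-fixpoint b 1≤d (V.≤h⇒<m d≤h))

  segment-unique : ∀ {S S' dr dr' d d'} → InRange (bound dr) d → InRange (bound dr') d' →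
                   SamePair S (shift dr d S) S' (shift dr' d' S') → dr ≡ dr' × d ≡ d' × S ≡ S'
  segment-unique {a , b} {a' , b'} {horizontal} {horizontal} r r' p
    with H.short-unique r r' (SamePair-map proj₁ p)
  ... | refl , refl = refl , refl , cong (a ,_) (SamePair-diagonalʳ (SamePair-map proj₂ p))
  segment-unique {a , b} {a' , b'} {vertical} {vertical} r r' p
    with V.short-unique r r' (SamePair-map proj₂ p)
  ... | refl , refl = refl , refl , cong (_, b) (SamePair-diagonalʳ (SamePair-map proj₁ p))
  segment-unique {a , b} {a' , b'} {horizontal} {vertical} _ (1≤d' , d'≤h) p =
    ⊥-elim (V.⊕-no-fixpoint b' 1≤d' (V.≤h⇒<m d'≤h) (SamePair-diagonalˡ (SamePair-map proj₂ p)))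
  segment-unique {a , b} {a' , b'} {vertical} {horizontal} _ (1≤d' , d'≤h) p =
    ⊥-elim (H.⊕-no-fixpoint a' 1≤d' (H.≤h⇒<m d'≤h) (SamePair-diagonalˡ (SamePair-map proj₁ p)))

  segment-exists : ∀ u v → Adj G u v →
                   Σ Point λ S → Σ Dir λ dr → Σ ℕ λ d →
                     InRange (bound dr) d × SamePair u v S (shift dr d S)
  segment-exists (a , b) (a , b') (inj₁ (refl , b≢b')) with V.short-exists b b' b≢b'
  ... | s , d , r , p = (a , s) , vertical , d , r , SamePair-map (a ,_) p
  segment-exists (a , b) (a' , b) (inj₂ (refl , a≢a')) with H.short-exists a a' a≢a'
  ... | s , d , r , p = (s , b) , horizontal , d , r , SamePair-map (_, b) p

  infixl 6 _⊞_ _⊟_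

  _⊞_ : Point → Plane → Point
  (a , b) ⊞ (x , y) = (a H.⊕ x , b V.⊕ y)

  _⊟_ : Point → Plane → Point
  (a , b) ⊟ (x , y) = (a H.⊖ x , b V.⊖ y)

  Fits : Plane → Set
  Fits (x , y) = x < m × y < n

  ⊞-move : ∀ t dr d p → t ⊞ move dr d p ≡ shift dr d (t ⊞ p)
  ⊞-move (a , b) horizontal d (x , y) = cong (_, b V.⊕ y) (sym (H.⊕-assoc a x d))
  ⊞-move (a , b) vertical   d (x , y) = cong (a H.⊕ x ,_) (sym (V.⊕-assoc b y d))

  ⊟-⊞ : ∀ S p → S ⊟ p ⊞ p ≡ S
  ⊟-⊞ (a , b) (x , y) = cong₂ _,_ (H.⊖-⊕ a x) (V.⊖-⊕ b y)

  ⊞-cancelʳ : ∀ {t t'} p → t ⊞ p ≡ t' ⊞ p → t ≡ t'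
  ⊞-cancelʳ (x , y) eq = cong₂ _,_ (H.⊕-cancelʳ x (cong proj₁ eq)) (V.⊕-cancelʳ y (cong proj₂ eq))

  ⊞-cancelˡ : ∀ t {p q} → Fits p → Fits q → t ⊞ p ≡ t ⊞ q → p ≡ q
  ⊞-cancelˡ (a , b) (x<m , y<n) (x'<m , y'<n) eq =
    cong₂ _,_ (H.⊕-cancelˡ a x<m x'<m (cong proj₁ eq)) (V.⊕-cancelˡ b y<n y'<n (cong proj₂ eq))

  record DifferenceFamily : Set₁ where
    field
      Block           : Set
      size            : ℕ
      enumerate       : Fin size ↔ Block
      place           : Block → Fin 8 → Plane
      fits            : ∀ β x → Fits (place β x)
      place-injective : ∀ β → Injective _≡_ _≡_ (place β)
      base            : Block → Fin 8 → Plane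
      dir             : Block → Fin 8 → Dir
      len             : Block → Fin 8 → ℕ
      len-range       : ∀ β e → InRange (bound (dir β e)) (len β e)
      edge-shape      : ∀ β e → SamePair (place β (src e)) (place β (tgt e))
                                         (base β e) (move (dir β e) (len β e) (base β e))
      difference-injective  : ∀ β e β' e' → dir β e ≡ dir β' e' → len β e ≡ len β' e' →
                              β ≡ β' × e ≡ e'
      difference-surjective : ∀ dr d → InRange (bound dr) d →
                              Σ Block λ β → Σ (Fin 8) λ e → dir β e ≡ dr × len β e ≡ d

  -- The translates t ⊞ β of all blocks by all torus points decompose G:
  -- the edge {u, v} lies in exactly the translate determined by its
  -- difference (which fixes β and e) and its base point (which fixes t).
  module Translates (F : DifferenceFamily) where
    open DifferenceFamily F

    translate-edge : ∀ t β e →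
      SamePair (t ⊞ place β (src e)) (t ⊞ place β (tgt e))
               (t ⊞ base β e) (shift (dir β e) (len β e) (t ⊞ base β e))
    translate-edge t β e =
      subst (SamePair _ _ _) (⊞-move t (dir β e) (len β e) (base β e))
            (SamePair-map (t ⊞_) (edge-shape β e))

    translate : Point × Block → L8Copy G
    translate (t , β) = record
      { vert  = λ x → t ⊞ place β x
      ; inj   = λ {x} {y} eq → place-injective β (⊞-cancelˡ t (fits β x) (fits β y) eq)
      ; edges = λ e → adj-respects-SamePair (translate-edge t β e)
                        (segment-adj (t ⊞ base β e) (dir β e) (len-range β e)) }

    translates-cover : ∀ u v → Adj G u v → ∃[ ι ] ∃[ e ] Covers (translate ι) e u v
    translates-cover u v adj with segment-exists u v adj
    ... | S , dr , d , r , uv with difference-surjective dr d r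
    ...   | β , e , refl , refl = (t , β) , e , SamePair-trans edge (SamePair-sym uv)
      where
      t : Point
      t = S ⊟ base β e
      edge : SamePair (t ⊞ place β (src e)) (t ⊞ place β (tgt e)) S (shift (dir β e) (len β e) S)
      edge = subst (λ X → SamePair (t ⊞ place β (src e)) (t ⊞ place β (tgt e))
                                   X (shift (dir β e) (len β e) X))
                   (⊟-⊞ S (base β e)) (translate-edge t β e)

    translates-unique : ∀ u v ι e ι' e' → Covers (translate ι) e u v → Covers (translate ι') e' u v →
                        ι ≡ ι' × e ≡ e'
    translates-unique u v (t , β) e (t' , β') e' c c'
      with segment-unique (len-range β e) (len-range β' e')
             (SamePair-trans (SamePair-sym (translate-edge t β e))
               (SamePair-trans c (SamePair-trans (SamePair-sym c') (translate-edge t' β' e'))))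
    ... | dr≡ , d≡ , S≡ with difference-injective β e β' e' dr≡ d≡
    ...   | refl , refl = cong (_, β) (⊞-cancelʳ (base β e) S≡) , refl

    decomposition : L8Decomposition G
    decomposition = decomposition-from-family index translate translates-cover translates-unique
      where
      index : Fin (m * n * size) ↔ (Point × Block)
      index = ↔-trans *↔× (*↔× ×-↔ enumerate)

retraction⇒injective : (f : A → B) (g : B → A) → (∀ x → g (f x) ≡ x) → Injective _≡_ _≡_ f
retraction⇒injective f g gf {x} {y} fx≡fy = trans (sym (gf x)) (trans (cong g fx≡fy) (gf y))

divmod-unique : ∀ k .{{_ : NonZero k}} {r r' q q'} → r < k → r' < k →
                r + q * k ≡ r' + q' * k → r ≡ r' × q ≡ q'
divmod-unique k {r} {r'} {q} {q'} r<k r'<k eq = r≡r' , q≡q'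
  where
  open ≡-Reasoning
  r≡r' : r ≡ r'
  r≡r' = begin
    r                  ≡⟨ m<n⇒m%n≡m r<k ⟨
    r % k              ≡⟨ [m+kn]%n≡m%n r q k ⟨
    (r + q * k) % k    ≡⟨ cong (_% k) eq ⟩
    (r' + q' * k) % k  ≡⟨ [m+kn]%n≡m%n r' q' k ⟩
    r' % k             ≡⟨ m<n⇒m%n≡m r'<k ⟩
    r'                 ∎
  q≡q' : q ≡ q'
  q≡q' = *-cancelʳ-≡ q q' k (+-cancelˡ-≡ r _ _ (trans eq (cong (_+ q' * k) (sym r≡r'))))

-- The special block: a copy of L_8 in ℕ² whose edges have the horizontal
-- lengths 1, ..., 6 and the vertical lengths 1, 2.
special-place : Fin 8 → Plane
special-place 0F = 0 , 0
special-place 1F = 1 , 0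
special-place 2F = 5 , 0
special-place 3F = 3 , 0
special-place 4F = 6 , 0
special-place 5F = 1 , 1
special-place 6F = 10 , 0
special-place 7F = 3 , 2

special-dir : Fin 8 → Dir
special-dir 5F = vertical
special-dir 7F = vertical
special-dir _  = horizontal

special-len : Fin 8 → ℕ
special-len 0F = 1
special-len 1F = 4
special-len 2F = 2
special-len 3F = 3
special-len 4F = 6
special-len 5F = 1
special-len 6F = 5
special-len 7F = 2

special-base : Fin 8 → Plane
special-base 0F = 0 , 0
special-base 1F = 1 , 0
special-base 2F = 3 , 0
special-base 3F = 0 , 0
special-base 4F = 0 , 0
special-base 5F = 1 , 0
special-base 6F = 5 , 0
special-base 7F = 3 , 0

special-shape : ∀ e → SamePair (special-place (src e)) (special-place (tgt e))
                               (special-base e) (move (special-dir e) (special-len e) (special-base e))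
special-shape 0F = inj₁ (refl , refl)
special-shape 1F = inj₁ (refl , refl)
special-shape 2F = inj₂ (refl , refl)
special-shape 3F = inj₂ (refl , refl)
special-shape 4F = inj₁ (refl , refl)
special-shape 5F = inj₁ (refl , refl)
special-shape 6F = inj₁ (refl , refl)
special-shape 7F = inj₁ (refl , refl)

special-place-decode : Plane → Fin 8
special-place-decode (0 , 0)  = 0F
special-place-decode (1 , 0)  = 1F
special-place-decode (5 , 0)  = 2F
special-place-decode (3 , 0)  = 3F
special-place-decode (6 , 0)  = 4F
special-place-decode (1 , 1)  = 5F
special-place-decode (10 , 0) = 6F
special-place-decode (3 , 2)  = 7F
special-place-decode _        = 0F

special-place-injective : Injective _≡_ _≡_ special-place
special-place-injective = retraction⇒injective special-place special-place-decode λ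
  { 0F → refl ; 1F → refl ; 2F → refl ; 3F → refl ; 4F → refl ; 5F → refl ; 6F → refl ; 7F → refl }

special-difference-decode : Dir → ℕ → Fin 8
special-difference-decode horizontal 1 = 0F
special-difference-decode horizontal 2 = 2F
special-difference-decode horizontal 3 = 3F
special-difference-decode horizontal 4 = 1F
special-difference-decode horizontal 5 = 6F
special-difference-decode horizontal 6 = 4F
special-difference-decode vertical   1 = 5F
special-difference-decode vertical   2 = 7F
special-difference-decode _          _ = 0F

special-difference-decode-correct : ∀ e → special-difference-decode (special-dir e) (special-len e) ≡ e
special-difference-decode-correct 0F = refl
special-difference-decode-correct 1F = refl
special-difference-decode-correct 2F = refl
special-difference-decode-correct 3F = refl
special-difference-decode-correct 4F = refl
special-difference-decode-correct 5F = refl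
special-difference-decode-correct 6F = refl
special-difference-decode-correct 7F = refl

special-bound : Dir → ℕ
special-bound horizontal = 6
special-bound vertical   = 2

special-in-range : ∀ e → InRange (special-bound (special-dir e)) (special-len e)
special-in-range 0F = s≤s z≤n , ≤ᵇ⇒≤ _ _ _
special-in-range 1F = s≤s z≤n , ≤ᵇ⇒≤ _ _ _
special-in-range 2F = s≤s z≤n , ≤ᵇ⇒≤ _ _ _
special-in-range 3F = s≤s z≤n , ≤ᵇ⇒≤ _ _ _
special-in-range 4F = s≤s z≤n , ≤ᵇ⇒≤ _ _ _
special-in-range 5F = s≤s z≤n , ≤ᵇ⇒≤ _ _ _
special-in-range 6F = s≤s z≤n , ≤ᵇ⇒≤ _ _ _
special-in-range 7F = s≤s z≤n , ≤ᵇ⇒≤ _ _ _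

special-fits : ∀ x → proj₁ (special-place x) ≤ 10 × proj₂ (special-place x) ≤ 2
special-fits 0F = ≤ᵇ⇒≤ _ _ _ , ≤ᵇ⇒≤ _ _ _
special-fits 1F = ≤ᵇ⇒≤ _ _ _ , ≤ᵇ⇒≤ _ _ _
special-fits 2F = ≤ᵇ⇒≤ _ _ _ , ≤ᵇ⇒≤ _ _ _
special-fits 3F = ≤ᵇ⇒≤ _ _ _ , ≤ᵇ⇒≤ _ _ _
special-fits 4F = ≤ᵇ⇒≤ _ _ _ , ≤ᵇ⇒≤ _ _ _
special-fits 5F = ≤ᵇ⇒≤ _ _ _ , ≤ᵇ⇒≤ _ _ _
special-fits 6F = ≤ᵇ⇒≤ _ _ _ , ≤ᵇ⇒≤ _ _ _
special-fits 7F = ≤ᵇ⇒≤ _ _ _ , ≤ᵇ⇒≤ _ _ _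

-- The line block with offset c: a copy of L_8 on the line ℕ whose eight
-- edges have the lengths 3 + c, ..., 10 + c; edge e has length
-- 3 + c + slot e for a permutation `slot` of Fin 8.
line-place : ℕ → Fin 8 → ℕ
line-place c 0F = 8 + c
line-place c 1F = 5
line-place c 2F = 10 + c
line-place c 3F = 0
line-place c 4F = 2
line-place c 5F = 9 + c
line-place c 6F = 1
line-place c 7F = 7 + c

line-base : Fin 8 → ℕ
line-base 0F = 5
line-base 1F = 5
line-base 2F = 0
line-base 3F = 0
line-base 4F = 2
line-base 5F = 5
line-base 6F = 1
line-base 7F = 0

slot : Fin 8 → Fin 8
slot 0F = 0F
slot 1F = 2F
slot 2F = 7F
slot 3F = 5F
slot 4F = 3F
slot 5F = 1F
slot 6F = 6F
slot 7F = 4F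

slot⁻¹ : Fin 8 → Fin 8
slot⁻¹ 0F = 0F
slot⁻¹ 1F = 5F
slot⁻¹ 2F = 1F
slot⁻¹ 3F = 4F
slot⁻¹ 4F = 7F
slot⁻¹ 5F = 3F
slot⁻¹ 6F = 6F
slot⁻¹ 7F = 2F

slot-slot⁻¹ : ∀ s → slot (slot⁻¹ s) ≡ s
slot-slot⁻¹ 0F = refl
slot-slot⁻¹ 1F = refl
slot-slot⁻¹ 2F = refl
slot-slot⁻¹ 3F = refl
slot-slot⁻¹ 4F = refl
slot-slot⁻¹ 5F = refl
slot-slot⁻¹ 6F = refl
slot-slot⁻¹ 7F = refl

slot⁻¹-slot : ∀ e → slot⁻¹ (slot e) ≡ e
slot⁻¹-slot 0F = refl
slot⁻¹-slot 1F = refl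
slot⁻¹-slot 2F = refl
slot⁻¹-slot 3F = refl
slot⁻¹-slot 4F = refl
slot⁻¹-slot 5F = refl
slot⁻¹-slot 6F = refl
slot⁻¹-slot 7F = refl

line-len : ℕ → Fin 8 → ℕ
line-len c e = toℕ (slot e) + (3 + c)

line-shape : ∀ c e → SamePair (line-place c (src e)) (line-place c (tgt e))
                              (line-base e) (line-base e + line-len c e)
line-shape c 0F = inj₂ (refl , refl)
line-shape c 1F = inj₁ (refl , refl)
line-shape c 2F = inj₂ (refl , refl)
line-shape c 3F = inj₁ (refl , refl)
line-shape c 4F = inj₂ (refl , refl)
line-shape c 5F = inj₁ (refl , refl)
line-shape c 6F = inj₂ (refl , refl)
line-shape c 7F = inj₁ (refl , refl)

line-place-decode : ℕ → ℕ → Fin 8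
line-place-decode c 0 = 3F
line-place-decode c 1 = 6F
line-place-decode c 2 = 4F
line-place-decode c 5 = 1F
line-place-decode c (suc (suc (suc (suc (suc (suc (suc k))))))) with k ∸ c
... | 0 = 7F
... | 1 = 0F
... | 2 = 5F
... | 3 = 2F
... | _ = 0F
line-place-decode c _ = 0F

line-place-injective : ∀ c → Injective _≡_ _≡_ (line-place c)
line-place-injective c = retraction⇒injective (line-place c) (line-place-decode c) decode-correct
  where
  decode-correct : ∀ x → line-place-decode c (line-place c x) ≡ x
  decode-correct 0F rewrite m+n∸n≡m 1 c = refl
  decode-correct 1F = refl
  decode-correct 2F rewrite m+n∸n≡m 3 c = refl
  decode-correct 3F = refl
  decode-correct 4F = refl
  decode-correct 5F rewrite m+n∸n≡m 2 c = refl
  decode-correct 6F = refl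
  decode-correct 7F rewrite m+n∸n≡m 0 c = refl

line-place-≤ : ∀ c x → line-place c x ≤ 10 + c
line-place-≤ c 0F = +-monoˡ-≤ c (≤ᵇ⇒≤ 8 10 _)
line-place-≤ c 1F = ≤-trans (≤ᵇ⇒≤ 5 10 _) (m≤m+n 10 c)
line-place-≤ c 2F = ≤-refl
line-place-≤ c 3F = z≤n
line-place-≤ c 4F = ≤-trans (≤ᵇ⇒≤ 2 10 _) (m≤m+n 10 c)
line-place-≤ c 5F = +-monoˡ-≤ c (≤ᵇ⇒≤ 9 10 _)
line-place-≤ c 6F = ≤-trans (≤ᵇ⇒≤ 1 10 _) (m≤m+n 10 c)
line-place-≤ c 7F = +-monoˡ-≤ c (≤ᵇ⇒≤ 7 10 _)

line-len-≥ : ∀ c e → 3 + c ≤ line-len c e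
line-len-≥ c e = m≤n+m (3 + c) (toℕ (slot e))

line-len-≤ : ∀ c e → line-len c e ≤ 10 + c
line-len-≤ c e = +-monoˡ-≤ (3 + c) (≤-pred (toℕ<n (slot e)))

-- With offset o + 8q the lengths are 3 + o + (slot e + 8q): Euclidean
-- division by 8 recovers q and e, and every 3 + o + k with k < 8c is hit
-- by a unique q < c.
line-len-split : ∀ o q e → line-len (o + q * 8) e ≡ (3 + o) + (toℕ (slot e) + q * 8)
line-len-split o q e = trans (cong (toℕ (slot e) +_) (sym (+-assoc 3 o (q * 8))))
                             (x∙yz≈y∙xz (toℕ (slot e)) (3 + o) (q * 8))

line-len-injective : ∀ o {q q' e e'} → line-len (o + q * 8) e ≡ line-len (o + q' * 8) e' →
                     q ≡ q' × e ≡ e'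
line-len-injective o {q} {q'} {e} {e'} eq with divmod-unique 8 (toℕ<n (slot e)) (toℕ<n (slot e'))
  (+-cancelˡ-≡ (3 + o) _ _ (trans (sym (line-len-split o q e)) (trans eq (line-len-split o q' e'))))
... | slot≡ , q≡q' = q≡q' , retraction⇒injective slot slot⁻¹ slot⁻¹-slot (toℕ-injective slot≡)

line-len-hit : ∀ o {c k} → k < c * 8 →
               Σ (Fin c) λ i → Σ (Fin 8) λ e → line-len (o + toℕ i * 8) e ≡ (3 + o) + k
line-len-hit o {c} {k} k<c*8 = fromℕ< q<c , slot⁻¹ (k mod 8) , (begin
  line-len (o + toℕ (fromℕ< q<c) * 8) (slot⁻¹ (k mod 8))
    ≡⟨ line-len-split o (toℕ (fromℕ< q<c)) (slot⁻¹ (k mod 8)) ⟩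
  (3 + o) + (toℕ (slot (slot⁻¹ (k mod 8))) + toℕ (fromℕ< q<c) * 8)
    ≡⟨ cong₂ (λ r q → (3 + o) + (toℕ r + q * 8)) (slot-slot⁻¹ (k mod 8)) (toℕ-fromℕ< q<c) ⟩
  (3 + o) + (toℕ (k mod 8) + k / 8 * 8)
    ≡⟨ cong (λ r → (3 + o) + (r + k / 8 * 8)) (toℕ-fromℕ< (m%n<n k 8)) ⟩
  (3 + o) + (k % 8 + k / 8 * 8)
    ≡⟨ cong ((3 + o) +_) (m≡m%n+[m/n]*n k 8) ⟨
  (3 + o) + k
    ∎)
  where
  open ≡-Reasoning
  q<c : k / 8 < c
  q<c = m<n*o⇒m/o<n k<c*8

pattern special  = inj₁ tt
pattern row i    = inj₂ (inj₁ i)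
pattern column j = inj₂ (inj₂ j)

-- The difference family for hm = 6 + 8a and hn = 2 + 8b: the special block,
-- for i < a the line block with offset 4 + 8i laid along the first axis
-- (horizontal lengths 7 + 8i .. 14 + 8i), and for j < b the line block with
-- offset 8j laid along the second axis (vertical lengths 3 + 8j .. 10 + 8j).
module Family (a b : ℕ) where

  hm hn : ℕ
  hm = 6 + a * 8
  hn = 2 + b * 8

  open Torus hm hn

  Block : Set
  Block = ⊤ ⊎ (Fin a ⊎ Fin b)

  enumerate : Fin (1 + (a + b)) ↔ Block
  enumerate = ↔-trans +↔⊎ (1↔⊤ ⊎-↔ +↔⊎)

  row-offset : Fin a → ℕ
  row-offset i = 4 + toℕ i * 8

  column-offset : Fin b → ℕ
  column-offset j = toℕ j * 8

  row-room : ∀ i → 10 + row-offset i ≤ hm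
  row-room i = +-monoʳ-≤ 6 (*-monoˡ-≤ 8 (toℕ<n i))

  column-room : ∀ j → 10 + column-offset j ≤ hn
  column-room j = +-monoʳ-≤ 2 (*-monoˡ-≤ 8 (toℕ<n j))

  special-bound-≤ : ∀ dr → special-bound dr ≤ bound dr
  special-bound-≤ horizontal = m≤m+n 6 (a * 8)
  special-bound-≤ vertical   = m≤m+n 2 (b * 8)

  -- The special block spans 11 × 3 points, and 11 ≤ m, 3 ≤ n.
  special-room : 10 ≤ hm + hm × 2 ≤ hn + hn
  special-room = ≤-trans (≤ᵇ⇒≤ 10 12 _) (+-mono-≤ (m≤m+n 6 (a * 8)) (m≤m+n 6 (a * 8)))
               , ≤-trans (≤ᵇ⇒≤ 2 4 _) (+-mono-≤ (m≤m+n 2 (b * 8)) (m≤m+n 2 (b * 8)))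

  place : Block → Fin 8 → Plane
  place special    x = special-place x
  place (row i)    x = line-place (row-offset i) x , 0
  place (column j) x = 0 , line-place (column-offset j) x

  base : Block → Fin 8 → Plane
  base special    e = special-base e
  base (row i)    e = line-base e , 0
  base (column j) e = 0 , line-base e

  dir : Block → Fin 8 → Dir
  dir special    e = special-dir e
  dir (row i)    e = horizontal
  dir (column j) e = vertical

  len : Block → Fin 8 → ℕ
  len special    e = special-len e
  len (row i)    e = line-len (row-offset i) e
  len (column j) e = line-len (column-offset j) e

  fits : ∀ β x → Fits (place β x)
  fits special    x = s≤s (≤-trans (proj₁ (special-fits x)) (proj₁ special-room))
                    , s≤s (≤-trans (proj₂ (special-fits x)) (proj₂ special-room))
  fits (row i)    x = H.≤h⇒<m (≤-trans (line-place-≤ (row-offset i) x) (row-room i)) , s≤s z≤n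
  fits (column j) x = s≤s z≤n , V.≤h⇒<m (≤-trans (line-place-≤ (column-offset j) x) (column-room j))

  place-injective : ∀ β → Injective _≡_ _≡_ (place β)
  place-injective special    = special-place-injective
  place-injective (row i)    = line-place-injective (row-offset i) ∘′ cong proj₁
  place-injective (column j) = line-place-injective (column-offset j) ∘′ cong proj₂

  len-range : ∀ β e → InRange (bound (dir β e)) (len β e)
  len-range special    e = proj₁ (special-in-range e)
                         , ≤-trans (proj₂ (special-in-range e)) (special-bound-≤ (special-dir e))
  len-range (row i)    e = ≤-trans (s≤s z≤n) (line-len-≥ (row-offset i) e)
                         , ≤-trans (line-len-≤ (row-offset i) e) (row-room i)
  len-range (column j) e = ≤-trans (s≤s z≤n) (line-len-≥ (column-offset j) e)
                         , ≤-trans (line-len-≤ (column-offset j) e) (column-room j)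

  edge-shape : ∀ β e → SamePair (place β (src e)) (place β (tgt e))
                                (base β e) (move (dir β e) (len β e) (base β e))
  edge-shape special    e = special-shape e
  edge-shape (row i)    e = SamePair-map (_, 0) (line-shape (row-offset i) e)
  edge-shape (column j) e = SamePair-map (0 ,_) (line-shape (column-offset j) e)

  special-shorter : ∀ e {dr c} e' → special-dir e ≡ dr → special-bound dr < 3 + c →
                    special-len e ≢ line-len c e'
  special-shorter e {c = c} e' refl short =
    <⇒≢ (≤-trans (s≤s (proj₂ (special-in-range e))) (≤-trans short (line-len-≥ c e')))

  difference-injective : ∀ β e β' e' → dir β e ≡ dir β' e' → len β e ≡ len β' e' →
                         β ≡ β' × e ≡ e'
  difference-injective special e special e' dr≡ len≡ =
    refl , trans (sym (special-difference-decode-correct e))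
                 (trans (cong₂ special-difference-decode dr≡ len≡) (special-difference-decode-correct e'))
  difference-injective (row i) e (row i') e' _ len≡ with line-len-injective 4 len≡
  ... | q≡q' , e≡e' = cong row (toℕ-injective q≡q') , e≡e'
  difference-injective (column j) e (column j') e' _ len≡ with line-len-injective 0 len≡
  ... | q≡q' , e≡e' = cong column (toℕ-injective q≡q') , e≡e'
  difference-injective special e (row i) e' dr≡ len≡ =
    ⊥-elim (special-shorter e e' dr≡ (s≤s (m≤m+n 6 _)) len≡)
  difference-injective special e (column j) e' dr≡ len≡ =
    ⊥-elim (special-shorter e e' dr≡ (s≤s (m≤m+n 2 _)) len≡)
  difference-injective (row i) e special e' dr≡ len≡ =
    ⊥-elim (special-shorter e' e (sym dr≡) (s≤s (m≤m+n 6 _)) (sym len≡))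
  difference-injective (column j) e special e' dr≡ len≡ =
    ⊥-elim (special-shorter e' e (sym dr≡) (s≤s (m≤m+n 2 _)) (sym len≡))
  difference-injective (row _)    _ (column _) _ () _
  difference-injective (column _) _ (row _)    _ () _

  difference-surjective : ∀ dr d → InRange (bound dr) d →
                          Σ Block λ β → Σ (Fin 8) λ e → dir β e ≡ dr × len β e ≡ d
  difference-surjective _          0 (() , _)
  difference-surjective horizontal 1 _ = special , 0F , refl , refl
  difference-surjective horizontal 2 _ = special , 2F , refl , refl
  difference-surjective horizontal 3 _ = special , 3F , refl , refl
  difference-surjective horizontal 4 _ = special , 1F , refl , refl
  difference-surjective horizontal 5 _ = special , 6F , refl , refl
  difference-surjective horizontal 6 _ = special , 4F , refl , refl
  difference-surjective horizontal (suc (suc (suc (suc (suc (suc (suc k)))))))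
                        (_ , s≤s (s≤s (s≤s (s≤s (s≤s (s≤s k<a*8)))))) with line-len-hit 4 k<a*8
  ... | i , e , hit = row i , e , refl , hit
  difference-surjective vertical 1 _ = special , 5F , refl , refl
  difference-surjective vertical 2 _ = special , 7F , refl , refl
  difference-surjective vertical (suc (suc (suc k))) (_ , s≤s (s≤s k<b*8)) with line-len-hit 0 k<b*8
  ... | j , e , hit = column j , e , refl , hit

  family : DifferenceFamily
  family = record
    { Block = Block ; size = 1 + (a + b) ; enumerate = enumerate
    ; place = place ; fits = fits ; place-injective = place-injective
    ; base = base ; dir = dir ; len = len ; len-range = len-range ; edge-shape = edge-shape
    ; difference-injective = difference-injective ; difference-surjective = difference-surjective }

  decomposition : L8Decomposition (K (suc (hm + hm)) □ K (suc (hn + hn)))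
  decomposition = Translates.decomposition family

residue-form : ∀ m r → m % 16 ≡ suc (r + r) → m ≡ suc ((r + m / 16 * 8) + (r + m / 16 * 8))
residue-form m r m%16 = begin
  m                                ≡⟨ m≡m%n+[m/n]*n m 16 ⟩
  m % 16 + k * 16                  ≡⟨ cong (_+ k * 16) m%16 ⟩
  suc ((r + r) + k * 16)           ≡⟨ cong (λ x → suc ((r + r) + x)) (*-distribˡ-+ k 8 8) ⟩
  suc ((r + r) + (k * 8 + k * 8))  ≡⟨ cong suc (interchange r r (k * 8) (k * 8)) ⟩
  suc ((r + k * 8) + (r + k * 8))  ∎
  where
  open ≡-Reasoning
  k : ℕ
  k = m / 16

lemma2p7 : (m n : ℕ) → m % 16 ≡ 13 → n % 16 ≡ 5 →
           L8Decomposition (K m □ K n)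
lemma2p7 m n m%16≡13 n%16≡5 =
  subst₂ (λ x y → L8Decomposition (K x □ K y))
         (sym (residue-form m 6 m%16≡13)) (sym (residue-form n 2 n%16≡5))
         (Family.decomposition (m / 16) (n / 16))
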